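{- Let $\Gamma$ be a finite abelian group, let $x\in\Gamma(3)$, let $m=\mathrm{ord}(x)$ and let $g=m/3$. Then: (i) $M_1(x)\cup M_2(x)=\bigcup_{h\in D_{g,3}}[x^h]$; (ii) $M_1(x)=\bigcup_{h\in D^1_{g,3}}\langle\!\langle x^h\rangle\!\rangle\cup\bigcup_{h\in D^2_{g,3}}\langle\!\langle -x^h\rangle\!\rangle$; (iii) $M_2(x)=\bigcup_{h\in D^1_{g,3}}\langle\!\langle -x^h\rangle\!\rangle\cup\bigcup_{h\in D^2_{g,3}}\langle\!\langle x^h\rangle\!\rangle$.
   Context: $\Gamma$ is written additively: $x^k$ denotes $kx$ and $-x$ is the inverse of $x$. $\Gamma(3)$ is the set of elements whose order is divisible by $3$. For $x\in\Gamma(3)$ and $r\in\{0,1,2\}$, put $M_r(x)=\{x^k:1\le k\le\mathrm{ord}(x),\ k\equiv r\pmod 3\}$. $[y]=\{z\in\Gamma:\langle z\rangle=\langle y\rangle\}$. For $y\in\Gamma(3)$ with $\mathrm{ord}(y)=q$, put $\langle\!\langle y\rangle\!\rangle=\{y^k:1\le k\le q-1,\ \gcd(k,q)=1,\ k\equiv1\pmod 3\}$. For an integer $g$: $D_{g,3}$ is the set of positive divisors of $g$ not divisible by $3$, and $D^r_{g,3}$ is the set of positive divisors $k$ of $g$ with $k\equiv r\pmod 3$. -}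

module Defs where

open import Level using (Level; _⊔_)
open import Algebra.Bundles using (AbelianGroup)
open import Data.Nat using (ℕ; zero; suc; _≤_; _<_; _%_; _/_)
open import Data.Nat.Divisibility using (_∣_)
open import Data.Nat.GCD using (gcd)
open import Data.Integer using (ℤ; +_; -[1+_])
open import Data.Fin using (Fin)
open import Data.Product using (Σ; ∃; _×_; _,_)
open import Data.Sum using (_⊎_)
open import Relation.Nullary using (¬_)
open import Relation.Binary.PropositionalEquality using (_≡_)
open import Function.Bundles using (_⇔_)

IsFinite : ∀ {c ℓ} → AbelianGroup c ℓ → Set (c ⊔ ℓ)
IsFinite G = Σ ℕ λ n → Σ (Fin n → Carrier) λ f → ∀ y → ∃ λ i → f i ≈ y
  where open AbelianGroup G

module AG {c ℓ} (G : AbelianGroup c ℓ) where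
  open AbelianGroup G

  -- additive notation: k ⊙ x is x^k = kx (natural multiple)
  infixr 8 _⊙_
  _⊙_ : ℕ → Carrier → Carrier
  zero  ⊙ x = ε
  suc n ⊙ x = x ∙ (n ⊙ x)

  -- integer multiple, and negation  - x  written  x ⁻¹
  _⊙ℤ_ : ℤ → Carrier → Carrier
  (+ n) ⊙ℤ x = n ⊙ x
  -[1+ n ] ⊙ℤ x = (suc n ⊙ x) ⁻¹

  IsOrder : Carrier → ℕ → Set ℓ
  IsOrder x q = (1 ≤ q) × (q ⊙ x ≈ ε) × (∀ k → 1 ≤ k → k < q → ¬ (k ⊙ x ≈ ε))

  InCyclic : Carrier → Carrier → Set ℓ
  InCyclic y w = ∃ λ (k : ℤ) → w ≈ k ⊙ℤ y

  InClass : Carrier → Carrier → Set (c ⊔ ℓ)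
  InClass y z = ∀ w → InCyclic z w ⇔ InCyclic y w

  InM : ℕ → Carrier → ℕ → Carrier → Set ℓ
  InM r x m z = ∃ λ k → (1 ≤ k) × (k ≤ m) × (k % 3 ≡ r) × (z ≈ k ⊙ x)

  InDouble : Carrier → Carrier → Set ℓ
  InDouble y z = ∃ λ q → IsOrder y q ×
    (∃ λ k → (1 ≤ k) × (suc k ≤ q) × (gcd k q ≡ 1) × (k % 3 ≡ 1) × (z ≈ k ⊙ y))

  InD : ℕ → ℕ → Set
  InD g h = (1 ≤ h) × (h ∣ g) × ¬ (3 ∣ h)

  InDr : ℕ → ℕ → ℕ → Set
  InDr r g h = (1 ≤ h) × (h ∣ g) × (h % 3 ≡ r)

-- Write z = k x with 3 ∤ k and let h = gcd(k, m). As 3 ∣ m and 3 ∤ k, also 3 ∤ h, so h ∣ g;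
-- and z = k′ (h x) where k′ = k / h is coprime to q = m / h = ord(h x). By Bézout, z and h x
-- then generate the same cyclic group, which gives (i). Modulo 3 we have k′ h ≡ k: if h ≡ k
-- then k′ ≡ 1 and z ∈ ⟨⟨h x⟩⟩, otherwise q − k′ ≡ 1 and z = (q − k′)(− h x) ∈ ⟨⟨− h x⟩⟩.
-- Conversely, such a k (± h x) with k ≡ 1 equals e x with e ≡ ± h ≢ 0 (mod 3), and reducing
-- e modulo m exhibits it in M₁ or M₂; membership in [h x] forces 3 ∤ e as well, since h x
-- is in turn a multiple of z and the residue mod 3 of a coefficient is determined mod m.

module Submission where

open import Defs
open import Algebra.Bundles using (AbelianGroup)
import Algebra.Properties.AbelianGroup as AbelianGroupProperties
import Algebra.Properties.Monoid.Mult as MonoidMultiplication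
open import Data.Integer using (+_; -[1+_])
open import Data.Nat
  using (ℕ; zero; suc; pred; _+_; _*_; _∸_; _≤_; _<_; _>_; _%_; _/_; z≤n; s≤s;
         NonZero; >-nonZero; >-nonZero⁻¹; ≢-nonZero; ≢-nonZero⁻¹)
open import Data.Nat.Properties
open import Data.Nat.DivMod
open import Data.Nat.Divisibility
open import Data.Nat.GCD using (gcd; gcd[m,n]∣m; gcd[m,n]∣n; gcd[m,n]≢0; module Bézout)
open import Data.Nat.Coprimality as Coprimality
  using (Coprime; coprime⇒gcd≡1; coprime-/gcd; coprime-divisor; coprime-Bézout)
open import Data.Nat.Primality using (Prime; prime?; prime⇒irreducible)
open import Data.Product using (∃; _×_; _,_; proj₁; proj₂)
open import Data.Sum using (_⊎_; inj₁; inj₂; [_,_]; swap)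
open import Function.Base using (_∘_)
open import Function.Bundles using (_⇔_; mk⇔; Equivalence)
open import Relation.Nullary using (¬_; contradiction)
open import Relation.Nullary.Decidable using (from-yes)
open import Relation.Binary.PropositionalEquality
  using (_≡_; _≢_; refl; cong; subst; subst₂; module ≡-Reasoning)
import Relation.Binary.PropositionalEquality as ≡
import Relation.Binary.Reasoning.Setoid as SetoidReasoning

prime-3 : Prime 3
prime-3 = from-yes (prime? 3)

prime∤⇒coprime : ∀ {p n} → Prime p → ¬ p ∣ n → Coprime p n
prime∤⇒coprime p p∤n (d∣p , d∣n) with prime⇒irreducible p d∣p
... | inj₁ d≡1 = d≡1
... | inj₂ refl = contradiction d∣n p∤n

coprime-∸ : ∀ {k q} → k ≤ q → Coprime k q → Coprime (q ∸ k) q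
coprime-∸ k≤q k⊥q (d∣q∸k , d∣q) =
  k⊥q (∣m+n∣m⇒∣n (subst (_ ∣_) (≡.sym (m∸n+n≡m k≤q)) d∣q) d∣q∸k , d∣q)

∤⇒>0 : ∀ {d n} → ¬ d ∣ n → n > 0
∤⇒>0 {d} d∤n = n≢0⇒n>0 λ { refl → d∤n (d ∣0) }

%≢0⇒∤ : ∀ {d n r} .{{_ : NonZero d}} → n % d ≡ r → r ≢ 0 → ¬ d ∣ n
%≢0⇒∤ {d} {n} n%d≡r r≢0 d∣n = r≢0 (≡.trans (≡.sym n%d≡r) (n∣m⇒m%n≡0 n d d∣n))

m∣n⇒%-cong : ∀ {d n k l} .{{_ : NonZero d}} .{{_ : NonZero n}} →
             d ∣ n → k % n ≡ l % n → k % d ≡ l % d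
m∣n⇒%-cong {d} {n} {k} {l} d∣n k≡l = begin
  k % d      ≡⟨ m∣n⇒o%n%m≡o%m d n k d∣n ⟨
  k % n % d  ≡⟨ cong (_% d) k≡l ⟩
  l % n % d  ≡⟨ m∣n⇒o%n%m≡o%m d n l d∣n ⟩
  l % d      ∎
  where open ≡-Reasoning

m%o≡1⇒[m*n]%o≡n%o : ∀ m n o .{{_ : NonZero o}} → m % o ≡ 1 → (m * n) % o ≡ n % o
m%o≡1⇒[m*n]%o≡n%o m n o m%o≡1 = begin
  (m * n) % o              ≡⟨ %-distribˡ-* m n o ⟩
  (m % o * (n % o)) % o    ≡⟨ cong (λ u → (u * (n % o)) % o) m%o≡1 ⟩
  (1 * (n % o)) % o        ≡⟨ cong (_% o) (*-identityˡ (n % o)) ⟩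
  n % o % o                ≡⟨ m%n%n≡m%n n o ⟩
  n % o                    ∎
  where open ≡-Reasoning

[m*n]%3≡n%3⇒m%3≡1 : ∀ m n → ¬ 3 ∣ n → (m * n) % 3 ≡ n % 3 → m % 3 ≡ 1
[m*n]%3≡n%3⇒m%3≡1 m n 3∤n eq =
  residues (m % 3) (n % 3) (m%n<n m 3) (m%n<n n 3) (3∤n ∘ m%n≡0⇒n∣m n 3)
           (≡.trans (≡.sym (%-distribˡ-* m n 3)) eq)
  where
  residues : ∀ u v → u < 3 → v < 3 → v ≢ 0 → (u * v) % 3 ≡ v → u ≡ 1
  residues _ 0 _ _ v≢0 _ = contradiction refl v≢0
  residues 1 _ _ _ _ _ = refl
  residues 0 (suc _) _ _ _ ()
  residues 2 1 _ _ _ ()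
  residues 2 2 _ _ _ ()
  residues 2 (suc (suc (suc _))) _ (s≤s (s≤s (s≤s ()))) _ _
  residues (suc (suc (suc _))) _ (s≤s (s≤s (s≤s ()))) _ _ _

data Opposite₃ : ℕ → ℕ → Set where
  one-two : Opposite₃ 1 2
  two-one : Opposite₃ 2 1

Opposite₃-sym : ∀ {r s} → Opposite₃ r s → Opposite₃ s r
Opposite₃-sym one-two = two-one
Opposite₃-sym two-one = one-two

Opposite₃⇒≢0 : ∀ {r s} → Opposite₃ r s → r ≢ 0
Opposite₃⇒≢0 one-two ()
Opposite₃⇒≢0 two-one ()

∤3⇒opposite-residues : ∀ {r s n} → Opposite₃ r s → ¬ 3 ∣ n → n % 3 ≡ r ⊎ n % 3 ≡ s
∤3⇒opposite-residues {n = n} o 3∤n =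
  residues o (n % 3) (m%n<n n 3) (3∤n ∘ m%n≡0⇒n∣m n 3)
  where
  residues : ∀ {r s} → Opposite₃ r s → ∀ u → u < 3 → u ≢ 0 → u ≡ r ⊎ u ≡ s
  residues _ 0 _ u≢0 = contradiction refl u≢0
  residues one-two 1 _ _ = inj₁ refl
  residues one-two 2 _ _ = inj₂ refl
  residues two-one 1 _ _ = inj₂ refl
  residues two-one 2 _ _ = inj₁ refl
  residues _ (suc (suc (suc _))) (s≤s (s≤s (s≤s ()))) _

opposite-complement : ∀ {r s} a {b} → Opposite₃ r s → 3 ∣ a + b → b % 3 ≡ s → a % 3 ≡ r
opposite-complement {r} {s} a {b} o 3∣a+b b%3≡s = residues o (a % 3) (m%n<n a 3) a+s≡0
  where
  open ≡-Reasoning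
  a+s≡0 : (a % 3 + s) % 3 ≡ 0
  a+s≡0 = begin
    (a % 3 + s) % 3        ≡⟨ cong (λ v → (a % 3 + v) % 3) b%3≡s ⟨
    (a % 3 + b % 3) % 3    ≡⟨ %-distribˡ-+ a b 3 ⟨
    (a + b) % 3            ≡⟨ n∣m⇒m%n≡0 (a + b) 3 3∣a+b ⟩
    0                      ∎
  residues : ∀ {r s} → Opposite₃ r s → ∀ u → u < 3 → (u + s) % 3 ≡ 0 → u ≡ r
  residues one-two 1 _ _ = refl
  residues two-one 2 _ _ = refl
  residues one-two 0 _ ()
  residues one-two 2 _ ()
  residues two-one 0 _ ()
  residues two-one 1 _ ()
  residues _ (suc (suc (suc _))) (s≤s (s≤s (s≤s ()))) _

module Multiples {c ℓ} (G : AbelianGroup c ℓ) where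
  open AbelianGroup G renaming (refl to ≈-refl; sym to ≈-sym; trans to ≈-trans)
  open AG G
  open AbelianGroupProperties G
    using (⁻¹-∙-comm; ε⁻¹≈ε; ⁻¹-involutive; inverseˡ-unique; inverseʳ-unique)
  open MonoidMultiplication monoid renaming (_×_ to _·_) using (×-congʳ; ×-homo-+; ×-assocˡ)
  open SetoidReasoning setoid

  ⊙≡· : ∀ n y → n ⊙ y ≡ n · y
  ⊙≡· zero    y = refl
  ⊙≡· (suc n) y = cong (y ∙_) (⊙≡· n y)

  ⊙-congʳ : ∀ n {y y′} → y ≈ y′ → n ⊙ y ≈ n ⊙ y′
  ⊙-congʳ n {y} {y′} rewrite ⊙≡· n y | ⊙≡· n y′ = ×-congʳ n

  ⊙-homo-+ : ∀ a b y → (a + b) ⊙ y ≈ a ⊙ y ∙ b ⊙ y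
  ⊙-homo-+ a b y rewrite ⊙≡· (a + b) y | ⊙≡· a y | ⊙≡· b y = ×-homo-+ y a b

  ⊙-assoc : ∀ a b y → (a * b) ⊙ y ≈ a ⊙ b ⊙ y
  ⊙-assoc a b y rewrite ⊙≡· (a * b) y | ⊙≡· b y | ⊙≡· a (b · y) = ≈-sym (×-assocˡ y a b)

  ⊙-ε : ∀ n → n ⊙ ε ≈ ε
  ⊙-ε zero    = ≈-refl
  ⊙-ε (suc n) = ≈-trans (identityˡ (n ⊙ ε)) (⊙-ε n)

  ⊙-⁻¹ : ∀ n y → n ⊙ (y ⁻¹) ≈ (n ⊙ y) ⁻¹
  ⊙-⁻¹ zero    y = ≈-sym ε⁻¹≈ε
  ⊙-⁻¹ (suc n) y = ≈-trans (∙-congˡ (⊙-⁻¹ n y)) (⁻¹-∙-comm y (n ⊙ y))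

  *-annihilates : ∀ a {n y} → n ⊙ y ≈ ε → (a * n) ⊙ y ≈ ε
  *-annihilates a {n} {y} n⊙y≈ε = begin
    (a * n) ⊙ y  ≈⟨ ⊙-assoc a n y ⟩
    a ⊙ n ⊙ y    ≈⟨ ⊙-congʳ a n⊙y≈ε ⟩
    a ⊙ ε        ≈⟨ ⊙-ε a ⟩
    ε            ∎

  annihilates-⊙ : ∀ n a y → n ⊙ y ≈ ε → n ⊙ a ⊙ y ≈ ε
  annihilates-⊙ n a y n⊙y≈ε = begin
    n ⊙ a ⊙ y    ≈⟨ ⊙-assoc n a y ⟨
    (n * a) ⊙ y  ≡⟨ cong (_⊙ y) (*-comm n a) ⟩
    (a * n) ⊙ y  ≈⟨ *-annihilates a n⊙y≈ε ⟩
    ε            ∎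

  ⁻¹≈⊙ : ∀ {n} .{{_ : NonZero n}} a y → n ⊙ y ≈ ε → (a ⊙ y) ⁻¹ ≈ (pred n * a) ⊙ y
  ⁻¹≈⊙ {n} a y n⊙y≈ε = ≈-sym (inverseʳ-unique (a ⊙ y) ((pred n * a) ⊙ y) (begin
    a ⊙ y ∙ (pred n * a) ⊙ y  ≈⟨ ⊙-homo-+ a (pred n * a) y ⟨
    (suc (pred n) * a) ⊙ y    ≡⟨ cong (λ k → (k * a) ⊙ y) (suc-pred n) ⟩
    (n * a) ⊙ y               ≈⟨ ⊙-assoc n a y ⟩
    n ⊙ a ⊙ y                 ≈⟨ annihilates-⊙ n a y n⊙y≈ε ⟩
    ε                         ∎))

  ⊙-⁻¹-complement : ∀ a b y → (a + b) ⊙ y ≈ ε → b ⊙ y ≈ a ⊙ (y ⁻¹)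
  ⊙-⁻¹-complement a b y a+b≈ε = ≈-trans
    (inverseʳ-unique (a ⊙ y) (b ⊙ y) (≈-trans (≈-sym (⊙-homo-+ a b y)) a+b≈ε))
    (≈-sym (⊙-⁻¹ a y))

  InCyclic-refl : ∀ y → InCyclic y y
  InCyclic-refl y = + 1 , ≈-sym (identityʳ y)

  InCyclic⇒⊙ : ∀ {n} .{{_ : NonZero n}} {y w} → n ⊙ y ≈ ε → InCyclic y w →
               ∃ λ k → w ≈ k ⊙ y
  InCyclic⇒⊙ _ (+ k , w≈k⊙y) = k , w≈k⊙y
  InCyclic⇒⊙ {n} {y} n⊙y≈ε (-[1+ k ] , w≈) =
    pred n * suc k , ≈-trans w≈ (⁻¹≈⊙ (suc k) y n⊙y≈ε)

  InCyclic-⊙ : ∀ {n} .{{_ : NonZero n}} {y y′ w} a →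
               n ⊙ y ≈ ε → y′ ≈ a ⊙ y → InCyclic y′ w → InCyclic y w
  InCyclic-⊙ {n} {y} {y′} {w} a n⊙y≈ε y′≈a⊙y w∈⟨y′⟩ = + (k * a) , (begin
    w            ≈⟨ w≈k⊙y′ ⟩
    k ⊙ y′       ≈⟨ ⊙-congʳ k y′≈a⊙y ⟩
    k ⊙ a ⊙ y    ≈⟨ ⊙-assoc k a y ⟨
    (k * a) ⊙ y  ∎)
    where
    n⊙y′≈ε : n ⊙ y′ ≈ ε
    n⊙y′≈ε = ≈-trans (⊙-congʳ n y′≈a⊙y) (annihilates-⊙ n a y n⊙y≈ε)
    k = proj₁ (InCyclic⇒⊙ n⊙y′≈ε w∈⟨y′⟩)
    w≈k⊙y′ = proj₂ (InCyclic⇒⊙ n⊙y′≈ε w∈⟨y′⟩)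

  InClass-intro : ∀ {n} .{{_ : NonZero n}} {y z} a b →
                  n ⊙ y ≈ ε → z ≈ a ⊙ y → y ≈ b ⊙ z → InClass y z
  InClass-intro {n} {y} a b n⊙y≈ε z≈a⊙y y≈b⊙z w =
    mk⇔ (InCyclic-⊙ a n⊙y≈ε z≈a⊙y)
        (InCyclic-⊙ b (≈-trans (⊙-congʳ n z≈a⊙y) (annihilates-⊙ n a y n⊙y≈ε)) y≈b⊙z)

  InClass⇒multiples : ∀ {n} .{{_ : NonZero n}} {y z} → n ⊙ y ≈ ε → InClass y z →
                      ∃ λ a → ∃ λ b → z ≈ a ⊙ y × y ≈ b ⊙ z
  InClass⇒multiples {n} {y} {z} n⊙y≈ε y∼z =
    a , b , z≈a⊙y , y≈b⊙z
    where
    z-multiple = InCyclic⇒⊙ n⊙y≈ε (Equivalence.to (y∼z z) (InCyclic-refl z))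
    a = proj₁ z-multiple
    z≈a⊙y = proj₂ z-multiple
    n⊙z≈ε = ≈-trans (⊙-congʳ n z≈a⊙y) (annihilates-⊙ n a y n⊙y≈ε)
    y-multiple = InCyclic⇒⊙ n⊙z≈ε (Equivalence.from (y∼z y) (InCyclic-refl y))
    b = proj₁ y-multiple
    y≈b⊙z = proj₂ y-multiple

  coprime⇒generates : ∀ {q} .{{_ : NonZero q}} {k y} → q ⊙ y ≈ ε → Coprime k q →
                      ∃ λ a → y ≈ a ⊙ k ⊙ y
  coprime⇒generates {q} {k} {y} q⊙y≈ε k⊥q with coprime-Bézout k⊥q
  ... | Bézout.+- a b 1+bq≡ak = a , (begin
    y                      ≈⟨ identityʳ y ⟨
    y ∙ ε                  ≈⟨ ∙-congˡ (*-annihilates b q⊙y≈ε) ⟨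
    suc (b * q) ⊙ y        ≡⟨ cong (_⊙ y) 1+bq≡ak ⟩
    (a * k) ⊙ y            ≈⟨ ⊙-assoc a k y ⟩
    a ⊙ k ⊙ y              ∎)
  ... | Bézout.-+ a b 1+ak≡bq = pred q * a , (begin
    y                          ≈⟨ inverseˡ-unique y ((a * k) ⊙ y) y∙ak≈ε ⟩
    ((a * k) ⊙ y) ⁻¹           ≈⟨ ⁻¹≈⊙ (a * k) y q⊙y≈ε ⟩
    (pred q * (a * k)) ⊙ y     ≡⟨ cong (_⊙ y) (*-assoc (pred q) a k) ⟨
    (pred q * a * k) ⊙ y       ≈⟨ ⊙-assoc (pred q * a) k y ⟩
    (pred q * a) ⊙ k ⊙ y       ∎)
    where
    y∙ak≈ε : y ∙ (a * k) ⊙ y ≈ ε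
    y∙ak≈ε = ≈-trans (reflexive (cong (_⊙ y) 1+ak≡bq)) (*-annihilates b q⊙y≈ε)

  InClass-coprime : ∀ {q} .{{_ : NonZero q}} {k y z} →
                    q ⊙ y ≈ ε → Coprime k q → z ≈ k ⊙ y → InClass y z
  InClass-coprime {k = k} q⊙y≈ε k⊥q z≈k⊙y =
    InClass-intro k a q⊙y≈ε z≈k⊙y (≈-trans y≈a⊙k⊙y (⊙-congʳ a (≈-sym z≈k⊙y)))
    where
    a = proj₁ (coprime⇒generates q⊙y≈ε k⊥q)
    y≈a⊙k⊙y = proj₂ (coprime⇒generates q⊙y≈ε k⊥q)

  InDouble-intro : ∀ {q k y z} → IsOrder y q → k % 3 ≡ 1 → k < q → Coprime k q →
                   z ≈ k ⊙ y → InDouble y z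
  InDouble-intro {q} {k} order k%3≡1 k<q k⊥q z≈k⊙y =
    q , order , k , ∤⇒>0 (%≢0⇒∤ k%3≡1 λ ()) , k<q , coprime⇒gcd≡1 k⊥q , k%3≡1 , z≈k⊙y

  IsOrder-⁻¹ : ∀ {y q} → IsOrder y q → IsOrder (y ⁻¹) q
  IsOrder-⁻¹ {y} {q} (q>0 , q⊙y≈ε , minimal) =
    q>0 ,
    ≈-trans (⊙-⁻¹ q y) (≈-trans (⁻¹-cong q⊙y≈ε) ε⁻¹≈ε) ,
    λ j j>0 j<q j⊙y⁻¹≈ε → minimal j j>0 j<q (begin
      j ⊙ y            ≈⟨ ⁻¹-involutive (j ⊙ y) ⟨
      ((j ⊙ y) ⁻¹) ⁻¹  ≈⟨ ⁻¹-cong (≈-trans (≈-sym (⊙-⁻¹ j y)) j⊙y⁻¹≈ε) ⟩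
      ε ⁻¹             ≈⟨ ε⁻¹≈ε ⟩
      ε                ∎)

  IsOrder-⊙ : ∀ {x m q h} → IsOrder x m → m ≡ q * h → IsOrder (h ⊙ x) q
  IsOrder-⊙ {x} {m} {q} {h} (m>0 , m⊙x≈ε , minimal) m≡q*h =
    >-nonZero⁻¹ q , q⊙h⊙x≈ε , λ j j>0 j<q j⊙h⊙x≈ε →
      minimal (j * h) (*-mono-≤ j>0 (>-nonZero⁻¹ h))
              (subst (j * h <_) (≡.sym m≡q*h) (*-monoˡ-< h j<q))
              (≈-trans (⊙-assoc j h x) j⊙h⊙x≈ε)
    where
    instance
      q*h≢0 : NonZero (q * h)
      q*h≢0 = >-nonZero (subst (0 <_) m≡q*h m>0)
      q≢0 : NonZero q
      q≢0 = m*n≢0⇒m≢0 q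
      h≢0 : NonZero h
      h≢0 = m*n≢0⇒n≢0 q
    q⊙h⊙x≈ε : q ⊙ h ⊙ x ≈ ε
    q⊙h⊙x≈ε = begin
      q ⊙ h ⊙ x    ≈⟨ ⊙-assoc q h x ⟨
      (q * h) ⊙ x  ≡⟨ cong (_⊙ x) m≡q*h ⟨
      m ⊙ x        ≈⟨ m⊙x≈ε ⟩
      ε            ∎

module Order {c ℓ} (G : AbelianGroup c ℓ) {x m} (ord : AG.IsOrder G x m) where
  open AbelianGroup G renaming (refl to ≈-refl; sym to ≈-sym; trans to ≈-trans)
  open AG G
  open Multiples G
  open AbelianGroupProperties G using (identityʳ-unique)
  open SetoidReasoning setoid

  instance
    m≢0 : NonZero m
    m≢0 = >-nonZero (proj₁ ord)

  m⊙x≈ε : m ⊙ x ≈ ε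
  m⊙x≈ε = proj₁ (proj₂ ord)

  ⊙-% : ∀ k → k ⊙ x ≈ (k % m) ⊙ x
  ⊙-% k = begin
    k ⊙ x                               ≡⟨ cong (_⊙ x) (m≡m%n+[m/n]*n k m) ⟩
    (k % m + k / m * m) ⊙ x             ≈⟨ ⊙-homo-+ (k % m) (k / m * m) x ⟩
    (k % m) ⊙ x ∙ (k / m * m) ⊙ x       ≈⟨ ∙-congˡ (*-annihilates (k / m) m⊙x≈ε) ⟩
    (k % m) ⊙ x ∙ ε                     ≈⟨ identityʳ ((k % m) ⊙ x) ⟩
    (k % m) ⊙ x                         ∎

  <m-annihilates⇒≡0 : ∀ {d} → d < m → d ⊙ x ≈ ε → d ≡ 0
  <m-annihilates⇒≡0 {zero}  _   _        = refl
  <m-annihilates⇒≡0 {suc d} d<m d⊙x≈ε =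
    contradiction d⊙x≈ε (proj₂ (proj₂ ord) (suc d) (s≤s z≤n) d<m)

  ⊙-injective-≤ : ∀ {u v} → u ≤ v → v < m → u ⊙ x ≈ v ⊙ x → u ≡ v
  ⊙-injective-≤ {u} {v} u≤v v<m u⊙x≈v⊙x =
    ≡.trans (≡.sym (+-identityʳ u)) (≡.trans (cong (λ e → u + e) (≡.sym d≡0)) (m+[n∸m]≡n u≤v))
    where
    d = v ∸ u
    d≡0 : d ≡ 0
    d≡0 = <m-annihilates⇒≡0 (≤-<-trans (m∸n≤m v u) v<m)
      (identityʳ-unique (u ⊙ x) (d ⊙ x) (begin
      u ⊙ x ∙ d ⊙ x  ≈⟨ ⊙-homo-+ u d x ⟨
      (u + d) ⊙ x    ≡⟨ cong (_⊙ x) (m+[n∸m]≡n u≤v) ⟩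
      v ⊙ x          ≈⟨ u⊙x≈v⊙x ⟨
      u ⊙ x          ∎))

  ⊙-injective-< : ∀ {u v} → u < m → v < m → u ⊙ x ≈ v ⊙ x → u ≡ v
  ⊙-injective-< {u} {v} u<m v<m u⊙x≈v⊙x with ≤-total u v
  ... | inj₁ u≤v = ⊙-injective-≤ u≤v v<m u⊙x≈v⊙x
  ... | inj₂ v≤u = ≡.sym (⊙-injective-≤ v≤u u<m (≈-sym u⊙x≈v⊙x))

  ⊙-injective-% : ∀ {k l} → k ⊙ x ≈ l ⊙ x → k % m ≡ l % m
  ⊙-injective-% {k} {l} k⊙x≈l⊙x = ⊙-injective-< (m%n<n k m) (m%n<n l m)
    (≈-trans (≈-sym (⊙-% k)) (≈-trans k⊙x≈l⊙x (⊙-% l)))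

  ∣-respects-⊙ : ∀ {d k l} .{{_ : NonZero d}} → d ∣ m → k ⊙ x ≈ l ⊙ x → d ∣ l → d ∣ k
  ∣-respects-⊙ {d} {k} {l} d∣m k⊙x≈l⊙x d∣l = m%n≡0⇒n∣m k d
    (≡.trans (m∣n⇒%-cong d∣m (⊙-injective-% k⊙x≈l⊙x)) (n∣m⇒m%n≡0 l d d∣l))

module Lemma2p13 {c ℓ} (G : AbelianGroup c ℓ) {x m} (ord : AG.IsOrder G x m) (3∣m : 3 ∣ m)
  where
  open AbelianGroup G renaming (refl to ≈-refl; sym to ≈-sym; trans to ≈-trans)
  open AG G
  open Multiples G
  open Order G ord

  g : ℕ
  g = m / 3

  InM-intro : ∀ {r z} e → e % 3 ≡ r → r ≢ 0 → z ≈ e ⊙ x → InM r x m z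
  InM-intro {r} e e%3≡r r≢0 z≈e⊙x =
    e % m , n≢0⇒n>0 e%m≢0 , m%n≤n e m , e%m%3≡r , ≈-trans z≈e⊙x (⊙-% e)
    where
    e%m%3≡r : e % m % 3 ≡ r
    e%m%3≡r = ≡.trans (m∣n⇒o%n%m≡o%m 3 m e 3∣m) e%3≡r
    e%m≢0 : e % m ≢ 0
    e%m≢0 e%m≡0 = r≢0 (≡.trans (≡.sym e%m%3≡r) (cong (_% 3) e%m≡0))

  InDoubleUnion : ℕ → ℕ → Carrier → Set ℓ
  InDoubleUnion r s z = (∃ λ h → InDr r g h × InDouble (h ⊙ x) z)
                      ⊎ (∃ λ h → InDr s g h × InDouble ((h ⊙ x) ⁻¹) z)

  module Decomposition {k z} (3∤k : ¬ 3 ∣ k) (k≤m : k ≤ m) (z≈k⊙x : z ≈ k ⊙ x) where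
    h : ℕ
    h = gcd k m

    instance
      h≢0 : NonZero h
      h≢0 = ≢-nonZero (gcd[m,n]≢0 k m (inj₂ (≢-nonZero⁻¹ m)))

    k′ q : ℕ
    k′ = k / h
    q = m / h

    k≡k′*h : k ≡ k′ * h
    k≡k′*h = ≡.sym (m/n*n≡m (gcd[m,n]∣m k m))

    k′h%3≡k%3 : (k′ * h) % 3 ≡ k % 3
    k′h%3≡k%3 = cong (_% 3) (≡.sym k≡k′*h)

    m≡q*h : m ≡ q * h
    m≡q*h = ≡.sym (m/n*n≡m (gcd[m,n]∣n k m))

    3∤h : ¬ 3 ∣ h
    3∤h 3∣h = 3∤k (∣-trans 3∣h (gcd[m,n]∣m k m))

    h∣g : h ∣ g
    h∣g = coprime-divisor (Coprimality.sym (prime∤⇒coprime prime-3 3∤h)) h∣3*g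
      where
      h∣3*g : h ∣ 3 * g
      h∣3*g = subst (h ∣_) (≡.trans (≡.sym (m/n*n≡m 3∣m)) (*-comm g 3)) (gcd[m,n]∣n k m)

    h∈D : InD g h
    h∈D = >-nonZero⁻¹ h , h∣g , 3∤h

    h∈Dr : ∀ {r} → h % 3 ≡ r → InDr r g h
    h∈Dr h%3≡r = >-nonZero⁻¹ h , h∣g , h%3≡r

    3∤k′ : ¬ 3 ∣ k′
    3∤k′ 3∣k′ = 3∤k (subst (3 ∣_) (≡.sym k≡k′*h) (∣m⇒∣m*n h 3∣k′))

    k′⊥q : Coprime k′ q
    k′⊥q = coprime-/gcd k m

    k′<q : k′ < q
    k′<q = *-cancelʳ-< h k′ q (subst₂ _<_ k≡k′*h m≡q*h k<m)
      where
      k<m : k < m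
      k<m = ≤∧≢⇒< k≤m λ k≡m → 3∤k (subst (3 ∣_) (≡.sym k≡m) 3∣m)

    h⊙x-order : IsOrder (h ⊙ x) q
    h⊙x-order = IsOrder-⊙ ord m≡q*h

    z≈k′⊙h⊙x : z ≈ k′ ⊙ h ⊙ x
    z≈k′⊙h⊙x = ≈-trans z≈k⊙x (≈-trans (reflexive (cong (_⊙ x) k≡k′*h)) (⊙-assoc k′ h x))

    InClass-h⊙x : InClass (h ⊙ x) z
    InClass-h⊙x =
      InClass-coprime {{>-nonZero (proj₁ h⊙x-order)}} (proj₁ (proj₂ h⊙x-order)) k′⊥q z≈k′⊙h⊙x

    InDouble-h⊙x : ∀ {r} → k % 3 ≡ r → h % 3 ≡ r → InDouble (h ⊙ x) z
    InDouble-h⊙x k%3≡r h%3≡r = InDouble-intro h⊙x-order k′%3≡1 k′<q k′⊥q z≈k′⊙h⊙x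
      where
      k′%3≡1 : k′ % 3 ≡ 1
      k′%3≡1 = [m*n]%3≡n%3⇒m%3≡1 k′ h 3∤h
        (≡.trans k′h%3≡k%3 (≡.trans k%3≡r (≡.sym h%3≡r)))

    -- With k′′ = q − k′ one has k′′ (− h x) = k′ (h x) = z, and k′′ h ≡ − k (mod 3)
    -- because (k′′ + k′) h = m; hence k′′ ≡ 1 (mod 3) when h ≡ − k.
    InDouble-h⊙x⁻¹ : ∀ {r s} → Opposite₃ r s → k % 3 ≡ r → h % 3 ≡ s →
                     InDouble ((h ⊙ x) ⁻¹) z
    InDouble-h⊙x⁻¹ o k%3≡r h%3≡s = InDouble-intro (IsOrder-⁻¹ h⊙x-order)
      k′′%3≡1 k′′<q (coprime-∸ (<⇒≤ k′<q) k′⊥q) z≈k′′⊙h⊙x⁻¹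
      where
      k′′ = q ∸ k′
      k′′+k′≡q : k′′ + k′ ≡ q
      k′′+k′≡q = m∸n+n≡m (<⇒≤ k′<q)
      k′′<q : k′′ < q
      k′′<q = subst (k′′ <_) k′′+k′≡q (m<m+n k′′ (∤⇒>0 3∤k′))
      3∣k′′h+k′h : 3 ∣ k′′ * h + k′ * h
      3∣k′′h+k′h = subst (3 ∣_) m≡k′′h+k′h 3∣m
        where
        open ≡-Reasoning
        m≡k′′h+k′h : m ≡ k′′ * h + k′ * h
        m≡k′′h+k′h = begin
          m                  ≡⟨ m≡q*h ⟩
          q * h              ≡⟨ cong (_* h) k′′+k′≡q ⟨
          (k′′ + k′) * h     ≡⟨ *-distribʳ-+ h k′′ k′ ⟩
          k′′ * h + k′ * h   ∎
      k′′%3≡1 : k′′ % 3 ≡ 1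
      k′′%3≡1 = [m*n]%3≡n%3⇒m%3≡1 k′′ h 3∤h (≡.trans
        (opposite-complement (k′′ * h) (Opposite₃-sym o) 3∣k′′h+k′h (≡.trans k′h%3≡k%3 k%3≡r))
        (≡.sym h%3≡s))
      z≈k′′⊙h⊙x⁻¹ : z ≈ k′′ ⊙ ((h ⊙ x) ⁻¹)
      z≈k′′⊙h⊙x⁻¹ = ≈-trans z≈k′⊙h⊙x (⊙-⁻¹-complement k′′ k′ (h ⊙ x)
        (≈-trans (reflexive (cong (_⊙ h ⊙ x) k′′+k′≡q)) (proj₁ (proj₂ h⊙x-order))))

    InDoubleUnion-intro : ∀ {r s} → Opposite₃ r s → k % 3 ≡ r → InDoubleUnion r s z
    InDoubleUnion-intro o k%3≡r =
      [ (λ h%3≡r → inj₁ (h , h∈Dr h%3≡r , InDouble-h⊙x k%3≡r h%3≡r))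
      , (λ h%3≡s → inj₂ (h , h∈Dr h%3≡s , InDouble-h⊙x⁻¹ o k%3≡r h%3≡s)) ]
      (∤3⇒opposite-residues o 3∤h)

  InM⇒InClass : ∀ {r s z} → Opposite₃ r s → InM r x m z →
                ∃ λ h → InD g h × InClass (h ⊙ x) z
  InM⇒InClass o (k , _ , k≤m , k%3≡r , z≈k⊙x) = h , h∈D , InClass-h⊙x
    where open Decomposition (%≢0⇒∤ k%3≡r (Opposite₃⇒≢0 o)) k≤m z≈k⊙x

  InClass⇒InM : ∀ {h z} → InD g h → InClass (h ⊙ x) z → InM 1 x m z ⊎ InM 2 x m z
  InClass⇒InM {h} {z} (_ , _ , 3∤h) h⊙x∼z =
    [ (λ e%3≡1 → inj₁ (InM-intro e e%3≡1 (λ ()) z≈e⊙x))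
    , (λ e%3≡2 → inj₂ (InM-intro e e%3≡2 (λ ()) z≈e⊙x)) ]
    (∤3⇒opposite-residues one-two 3∤e)
    where
    multiples = InClass⇒multiples (annihilates-⊙ m h x m⊙x≈ε) h⊙x∼z
    a = proj₁ multiples
    b = proj₁ (proj₂ multiples)
    e = a * h
    z≈e⊙x : z ≈ e ⊙ x
    z≈e⊙x = ≈-trans (proj₁ (proj₂ (proj₂ multiples))) (≈-sym (⊙-assoc a h x))
    h⊙x≈be⊙x : h ⊙ x ≈ (b * e) ⊙ x
    h⊙x≈be⊙x = ≈-trans (proj₂ (proj₂ (proj₂ multiples)))
                        (≈-trans (⊙-congʳ b z≈e⊙x) (≈-sym (⊙-assoc b e x)))
    3∤e : ¬ 3 ∣ e
    3∤e 3∣e = 3∤h (∣-respects-⊙ 3∣m h⊙x≈be⊙x (∣n⇒∣m*n b 3∣e))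

  InM⇒InDoubleUnion : ∀ {r s z} → Opposite₃ r s → InM r x m z → InDoubleUnion r s z
  InM⇒InDoubleUnion o (k , _ , k≤m , k%3≡r , z≈k⊙x) = InDoubleUnion-intro o k%3≡r
    where open Decomposition (%≢0⇒∤ k%3≡r (Opposite₃⇒≢0 o)) k≤m z≈k⊙x

  InDoubleUnion⇒InM : ∀ {r s z} → Opposite₃ r s → InDoubleUnion r s z → InM r x m z
  InDoubleUnion⇒InM o (inj₁ (h , (_ , _ , h%3≡r) , _ , _ , k , _ , _ , _ , k%3≡1 , z≈k⊙h⊙x))
    =
    InM-intro (k * h) (≡.trans (m%o≡1⇒[m*n]%o≡n%o k h 3 k%3≡1) h%3≡r) (Opposite₃⇒≢0 o)
              (≈-trans z≈k⊙h⊙x (≈-sym (⊙-assoc k h x)))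
  InDoubleUnion⇒InM {r} {s} {z} o
                    (inj₂ (h , (_ , _ , h%3≡s) , _ , _ , k , _ , _ , _ , k%3≡1 , z≈k⊙h⊙x⁻¹))
    =
    InM-intro e e%3≡r (Opposite₃⇒≢0 o) z≈e⊙x
    where
    e = pred m * (k * h)
    3∣e+kh : 3 ∣ e + k * h
    3∣e+kh = subst (3 ∣_) m*kh≡e+kh (∣m⇒∣m*n (k * h) 3∣m)
      where
      open ≡-Reasoning
      m*kh≡e+kh : m * (k * h) ≡ e + k * h
      m*kh≡e+kh = begin
        m * (k * h)              ≡⟨ cong (_* (k * h)) (suc-pred m) ⟨
        suc (pred m) * (k * h)   ≡⟨ +-comm (k * h) e ⟩
        e + k * h                ∎
    e%3≡r : e % 3 ≡ r
    e%3≡r = opposite-complement e o 3∣e+kh (≡.trans (m%o≡1⇒[m*n]%o≡n%o k h 3 k%3≡1) h%3≡s)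
    z≈e⊙x : z ≈ e ⊙ x
    z≈e⊙x = ≈-trans z≈k⊙h⊙x⁻¹ (≈-trans (⊙-⁻¹ k (h ⊙ x))
      (≈-trans (⁻¹-cong (≈-sym (⊙-assoc k h x))) (⁻¹≈⊙ (k * h) x m⊙x≈ε)))

  part-i : ∀ z → (InM 1 x m z ⊎ InM 2 x m z) ⇔ (∃ λ h → InD g h × InClass (h ⊙ x) z)
  part-i z = mk⇔ [ InM⇒InClass one-two , InM⇒InClass two-one ]
                 (λ (h , h∈D , h⊙x∼z) → InClass⇒InM h∈D h⊙x∼z)

  part-ii-iii : ∀ {r s} → Opposite₃ r s → ∀ z → InM r x m z ⇔ InDoubleUnion r s z
  part-ii-iii o z = mk⇔ (InM⇒InDoubleUnion o) (InDoubleUnion⇒InM o)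

lemma2p13 : ∀ {c ℓ} (G : AbelianGroup c ℓ) → IsFinite G →
    let open AbelianGroup G
        open AG G
    in ∀ (x : Carrier) (m : ℕ) → IsOrder x m → 3 ∣ m →
       let g = m / 3 in
       (∀ z → (InM 1 x m z ⊎ InM 2 x m z) ⇔ (∃ λ h → InD g h × InClass (h ⊙ x) z))
       × (∀ z → InM 1 x m z ⇔
            ((∃ λ h → InDr 1 g h × InDouble (h ⊙ x) z)
             ⊎ (∃ λ h → InDr 2 g h × InDouble ((h ⊙ x) ⁻¹) z)))
       × (∀ z → InM 2 x m z ⇔
            ((∃ λ h → InDr 1 g h × InDouble ((h ⊙ x) ⁻¹) z)
             ⊎ (∃ λ h → InDr 2 g h × InDouble (h ⊙ x) z)))
lemma2p13 G _ x m ord 3∣m =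
  part-i ,
  part-ii-iii one-two ,
  λ z → mk⇔ (swap ∘ Equivalence.to (part-ii-iii two-one z))
             (Equivalence.from (part-ii-iii two-one z) ∘ swap)
  where open Lemma2p13 G ord 3∣m
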